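{- Let $G$ be a finite group and $H$ a subgroup of $G$. If the core of $H$ in $G$ is not contained in the center of $G$, then there is no connected Cayley sum graph of $G$ admitting $H$ as a perfect code. In particular, if $H$ is normal in $G$ and not contained in the center of $G$, then $H$ is not a perfect code of any connected Cayley sum graph of $G$.
   Context: All groups are finite. A subset $X$ of $G$ is normal if $g^{ -1}Xg=X$ for all $g\in G$. For a normal subset $X$ of $G$, the Cayley sum graph $\mathrm{CS}(G,X)$ is the simple graph with vertex set $G$ in which distinct vertices $g,h$ are adjacent iff $gh\in X$; a Cayley sum graph of $G$ is any such graph. A perfect code in a graph is an independent set $C$ of vertices such that every vertex outside $C$ has exactly one neighbour in $C$. The core of $H$ in $G$ is the largest normal subgroup of $G$ contained in $H$. -}

module Defs where

open import Level using (0ℓ)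
open import Data.Nat using (ℕ)
open import Data.Fin using (Fin)
open import Data.Fin.Subset using (Subset; _∈_; _∉_)
open import Data.Product using (Σ; ∃; _×_; _,_)
open import Relation.Binary.PropositionalEquality using (_≡_; _≢_)
open import Relation.Nullary using (¬_)
open import Algebra.Core using (Op₁; Op₂)
open import Algebra.Structures using (IsGroup)

-- A finite group: a group structure (with propositional equality) on Fin n.
-- Every finite group is isomorphic to one of this form.
record FinGroup : Set where
  field
    n       : ℕ
    _∙_     : Op₂ (Fin n)
    ε       : Fin n
    _⁻¹     : Op₁ (Fin n)
    isGroup : IsGroup _≡_ _∙_ ε _⁻¹
  infixl 7 _∙_
  infix 8 _⁻¹

module _ (G : FinGroup) where
  open FinGroup G

  IsSubgroup : Subset n → Set
  IsSubgroup H = (ε ∈ H)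
               × (∀ x y → x ∈ H → y ∈ H → (x ∙ y) ∈ H)
               × (∀ x → x ∈ H → (x ⁻¹) ∈ H)

  IsNormalSubset : Subset n → Set
  IsNormalSubset X = ∀ g →
      (∀ x → x ∈ X → (g ⁻¹ ∙ x ∙ g) ∈ X)
    × (∀ y → y ∈ X → ∃ λ x → x ∈ X × y ≡ g ⁻¹ ∙ x ∙ g)

  IsNormalSubgroup : Subset n → Set
  IsNormalSubgroup N = IsSubgroup N × IsNormalSubset N

  _⊆ₛ_ : Subset n → Subset n → Set
  A ⊆ₛ B = ∀ x → x ∈ A → x ∈ B

  IsCoreOf : Subset n → Subset n → Set
  IsCoreOf H K = IsNormalSubgroup K × (K ⊆ₛ H)
               × (∀ N → IsNormalSubgroup N → N ⊆ₛ H → N ⊆ₛ K)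

  InCenter : Subset n → Set
  InCenter A = ∀ x → x ∈ A → ∀ g → x ∙ g ≡ g ∙ x

  CSAdj : Subset n → Fin n → Fin n → Set
  CSAdj X g h = (g ≢ h) × ((g ∙ h) ∈ X)

module _ {V : Set} (Adj : V → V → Set) where

  data Walk : V → V → Set where
    [] : ∀ {v} → Walk v v
    _∷_ : ∀ {u v w} → Adj u v → Walk v w → Walk u w

  Connected : Set
  Connected = ∀ u v → Walk u v

module _ {m : ℕ} (Adj : Fin m → Fin m → Set) where
  IsPerfectCode : Subset m → Set
  IsPerfectCode C =
      (∀ c d → c ∈ C → d ∈ C → ¬ Adj c d)
    × (∀ v → v ∉ C →
         Σ (Fin m) λ c → (c ∈ C × Adj v c)
           × (∀ d → d ∈ C → Adj v d → d ≡ c))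

-- Every element x of the connection set X centralizes each normal subset N of G lying in the
-- code H: either x ∈ H, and then x = ε since x and ε would otherwise be adjacent code words,
-- or x ∉ H, and then v = k⁻¹x (k ∈ N) lies outside H with the two code neighbours k and
-- x⁻¹kx, which must coincide. Along an edge u ~ w of CS(G,X) we have w = u⁻¹(uw) with uw ∈ X,
-- so by connectedness every element of G centralizes N.
module Submission where

open import Level using (0ℓ)
open import Data.Fin using (Fin; _≟_)
open import Data.Fin.Subset using (Subset; _∈_; _∉_)
open import Data.Fin.Subset.Properties using (_∈?_)
open import Data.Product using (_×_; _,_; proj₁; proj₂)
open import Data.Empty using (⊥-elim)
open import Relation.Nullary using (¬_; yes; no)
open import Relation.Binary.PropositionalEquality
open import Algebra.Structures using (IsGroup)
open import Algebra.Bundles using (Group)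
import Algebra.Properties.Group as GroupProperties

open import Defs

perfectCode-uniqueNeighbour : ∀ {m} {Adj : Fin m → Fin m → Set} {C : Subset m} →
  IsPerfectCode Adj C → ∀ {v c d} → v ∉ C → c ∈ C → d ∈ C → Adj v c → Adj v d → c ≡ d
perfectCode-uniqueNeighbour (_ , cover) v∉C c∈C d∈C v~c v~d
  with cover _ v∉C
... | _ , _ , unique = trans (unique _ c∈C v~c) (sym (unique _ d∈C v~d))

module _ (G : FinGroup) where
  open FinGroup G
  open IsGroup isGroup using (assoc; identityˡ; identityʳ)

  group : Group 0ℓ 0ℓ
  group = record { isGroup = isGroup }

  open GroupProperties group using (\\-leftDividesˡ; \\-leftDividesʳ; //-rightDividesʳ)
  open ≡-Reasoning

  Centralizes : Subset n → Fin n → Set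
  Centralizes A g = ∀ a → a ∈ A → g ∙ a ≡ a ∙ g

  ε-centralizes : ∀ {A} → Centralizes A ε
  ε-centralizes a _ = trans (identityˡ a) (sym (identityʳ a))

  ⁻¹-centralizes : ∀ {A} g → Centralizes A g → Centralizes A (g ⁻¹)
  ⁻¹-centralizes g gA a a∈A = begin
    g ⁻¹ ∙ a                ≡⟨ cong (g ⁻¹ ∙_) (//-rightDividesʳ g a) ⟨
    g ⁻¹ ∙ (a ∙ g ∙ g ⁻¹)   ≡⟨ cong (λ b → g ⁻¹ ∙ (b ∙ g ⁻¹)) (gA a a∈A) ⟨
    g ⁻¹ ∙ (g ∙ a ∙ g ⁻¹)   ≡⟨ cong (g ⁻¹ ∙_) (assoc g a (g ⁻¹)) ⟩
    g ⁻¹ ∙ (g ∙ (a ∙ g ⁻¹)) ≡⟨ \\-leftDividesʳ g (a ∙ g ⁻¹) ⟩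
    a ∙ g ⁻¹                ∎

  ∙-centralizes : ∀ {A} g h → Centralizes A g → Centralizes A h → Centralizes A (g ∙ h)
  ∙-centralizes g h gA hA a a∈A = begin
    g ∙ h ∙ a   ≡⟨ assoc g h a ⟩
    g ∙ (h ∙ a) ≡⟨ cong (g ∙_) (hA a a∈A) ⟩
    g ∙ (a ∙ h) ≡⟨ assoc g a h ⟨
    g ∙ a ∙ h   ≡⟨ cong (_∙ h) (gA a a∈A) ⟩
    a ∙ g ∙ h   ≡⟨ assoc a g h ⟩
    a ∙ (g ∙ h) ∎

  conjugate-fixed⇒commute : ∀ x k → k ≡ x ⁻¹ ∙ k ∙ x → x ∙ k ≡ k ∙ x
  conjugate-fixed⇒commute x k k≡kˣ = begin
    x ∙ k                ≡⟨ cong (x ∙_) k≡kˣ ⟩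
    x ∙ (x ⁻¹ ∙ k ∙ x)   ≡⟨ cong (x ∙_) (assoc (x ⁻¹) k x) ⟩
    x ∙ (x ⁻¹ ∙ (k ∙ x)) ≡⟨ \\-leftDividesˡ x (k ∙ x) ⟩
    k ∙ x                ∎

  module _ {A X : Subset n} (X-centralizes : ∀ x → x ∈ X → Centralizes A x) where

    centralizes-along-walk : ∀ {u w} → Walk (CSAdj G X) u w → Centralizes A u → Centralizes A w
    centralizes-along-walk []                       uA = uA
    centralizes-along-walk {u} (_∷_ {v = v} (_ , uv∈X) walk) uA =
      centralizes-along-walk walk
        (subst (Centralizes A) (\\-leftDividesʳ u v)
          (∙-centralizes _ _ (⁻¹-centralizes u uA) (X-centralizes _ uv∈X)))

    connected⇒inCenter : Connected (CSAdj G X) → InCenter G A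
    connected⇒inCenter connected a a∈A g =
      sym (centralizes-along-walk (connected ε g) ε-centralizes a a∈A)

  module _ {H X : Subset n} (H-subgroup : IsSubgroup G H) (X-normal : IsNormalSubset G X)
           (H-code : IsPerfectCode (CSAdj G X) H) where

    private
      ε∈H : ε ∈ H
      ε∈H = proj₁ H-subgroup

      ∙-closed : ∀ x y → x ∈ H → y ∈ H → x ∙ y ∈ H
      ∙-closed = proj₁ (proj₂ H-subgroup)

      ∉⇒≢ : ∀ {v d} → v ∉ H → d ∈ H → v ≢ d
      ∉⇒≢ v∉H d∈H refl = v∉H d∈H

    code∩connectionSet⊆ε : ∀ x → x ∈ H → x ∈ X → x ≡ ε
    code∩connectionSet⊆ε x x∈H x∈X with x ≟ ε
    ... | yes x≡ε = x≡ε
    ... | no  x≢ε = ⊥-elim (proj₁ H-code x ε x∈H ε∈H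
                              (x≢ε , subst (_∈ X) (sym (identityʳ x)) x∈X))

    module _ {N : Subset n} (N-normal : IsNormalSubset G N) (N⊆H : ∀ k → k ∈ N → k ∈ H) where

      connectionSet∖code-centralizes : ∀ x → x ∈ X → x ∉ H → Centralizes N x
      connectionSet∖code-centralizes x x∈X x∉H k k∈N =
        conjugate-fixed⇒commute x k
          (perfectCode-uniqueNeighbour H-code v∉H k∈H kˣ∈H v~k v~kˣ)
        where
        k∈H : k ∈ H
        k∈H = N⊆H k k∈N

        v kˣ : Fin n
        v = k ⁻¹ ∙ x
        kˣ = x ⁻¹ ∙ k ∙ x

        kˣ∈H : kˣ ∈ H
        kˣ∈H = N⊆H kˣ (proj₁ (N-normal x) k k∈N)

        v∉H : v ∉ H
        v∉H v∈H = x∉H (subst (_∈ H) (\\-leftDividesˡ k x) (∙-closed k v k∈H v∈H))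

        v~k : CSAdj G X v k
        v~k = ∉⇒≢ v∉H k∈H , proj₁ (X-normal k) x x∈X

        v∙kˣ≡x : v ∙ kˣ ≡ x
        v∙kˣ≡x = begin
          k ⁻¹ ∙ x ∙ (x ⁻¹ ∙ k ∙ x)     ≡⟨ cong (k ⁻¹ ∙ x ∙_) (assoc (x ⁻¹) k x) ⟩
          k ⁻¹ ∙ x ∙ (x ⁻¹ ∙ (k ∙ x))   ≡⟨ assoc (k ⁻¹) x _ ⟩
          k ⁻¹ ∙ (x ∙ (x ⁻¹ ∙ (k ∙ x))) ≡⟨ cong (k ⁻¹ ∙_) (\\-leftDividesˡ x (k ∙ x)) ⟩
          k ⁻¹ ∙ (k ∙ x)                ≡⟨ \\-leftDividesʳ k x ⟩
          x                             ∎

        v~kˣ : CSAdj G X v kˣ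
        v~kˣ = ∉⇒≢ v∉H kˣ∈H , subst (_∈ X) (sym v∙kˣ≡x) x∈X

      connectionSet-centralizes : ∀ x → x ∈ X → Centralizes N x
      connectionSet-centralizes x x∈X with x ∈? H
      ... | yes x∈H = subst (Centralizes N) (sym (code∩connectionSet⊆ε x x∈H x∈X)) ε-centralizes
      ... | no  x∉H = connectionSet∖code-centralizes x x∈X x∉H

      normal⊆perfectCode⇒inCenter : Connected (CSAdj G X) → InCenter G N
      normal⊆perfectCode⇒inCenter = connected⇒inCenter connectionSet-centralizes

theorem3p5 : (G : FinGroup) → (H : Subset (FinGroup.n G)) → IsSubgroup G H
    → ((K : Subset (FinGroup.n G)) → IsCoreOf G H K → ¬ InCenter G K
        → (X : Subset (FinGroup.n G)) → IsNormalSubset G X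
        → Connected (CSAdj G X) → ¬ IsPerfectCode (CSAdj G X) H)
    × (IsNormalSubset G H → ¬ InCenter G H
        → (X : Subset (FinGroup.n G)) → IsNormalSubset G X
        → Connected (CSAdj G X) → ¬ IsPerfectCode (CSAdj G X) H)
theorem3p5 G H H-subgroup = core-case , normal-case
  where
  core-case : (K : Subset (FinGroup.n G)) → IsCoreOf G H K → ¬ InCenter G K
    → (X : Subset (FinGroup.n G)) → IsNormalSubset G X
    → Connected (CSAdj G X) → ¬ IsPerfectCode (CSAdj G X) H
  core-case K ((_ , K-normal) , K⊆H , _) K∉Z X X-normal connected H-code =
    K∉Z (normal⊆perfectCode⇒inCenter G H-subgroup X-normal H-code K-normal K⊆H connected)

  normal-case : IsNormalSubset G H → ¬ InCenter G H
    → (X : Subset (FinGroup.n G)) → IsNormalSubset G X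
    → Connected (CSAdj G X) → ¬ IsPerfectCode (CSAdj G X) H
  normal-case H-normal H∉Z X X-normal connected H-code =
    H∉Z (normal⊆perfectCode⇒inCenter G H-subgroup X-normal H-code H-normal (λ _ h∈H → h∈H) connected)
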